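{- Let $(G,\mathcal B)$ be a biased graph and suppose $u$ is a balancing vertex of $(G,\mathcal B)$. There exists an equivalence relation $\sim$ on $\delta(u)$ such that a cycle $C$ of $G$ containing $u$ is balanced if and only if it contains two edges from the same equivalence class.
   Context: A biased graph $(G,\mathcal B)$: a graph $G$ with a collection $\mathcal B$ of cycles (loops are cycles of length one), called balanced, such that no theta subgraph contains exactly two balanced cycles. A vertex $u$ is balancing if every cycle of $G-u$ is balanced. $\delta(u)$ denotes the set of links (non-loop edges) incident with $u$. -}

module Defs where

open import Level using (0ℓ)
open import Data.Nat using (ℕ; suc)
open import Data.Nat.DivMod using (_mod_)
open import Data.Fin using (Fin; zero; suc; toℕ; inject₁; fromℕ; _≟_)
open import Data.Fin.Subset using (Subset; _∈_; _∪_)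
open import Data.Vec using (tabulate)
open import Data.Bool using (Bool; true)
open import Data.Product using (Σ; Σ-syntax; ∃; ∃-syntax; _×_; _,_; proj₁; proj₂)
open import Data.Sum using (_⊎_)
open import Relation.Nullary using (¬_; does)
open import Relation.Nullary.Decidable using (⌊_⌋)
open import Relation.Binary.PropositionalEquality using (_≡_; _≢_)
open import Relation.Binary using (Rel; IsEquivalence)
open import Function using (Injective)
open import Data.Fin.Properties using (any?)

-- A finite (multi)graph: vertices Fin n, edges Fin m, each edge has two
-- (unordered) ends; an edge with equal ends is a loop.
record Graph : Set where
  field
    n    : ℕ
    m    : ℕ
    ends : Fin m → Fin n × Fin n

module _ (G : Graph) where
  open Graph G

  V E : Set
  V = Fin n
  E = Fin m

  Joins : E → V → V → Set
  Joins e a b = ends e ≡ (a , b) ⊎ ends e ≡ (b , a)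

  Incident : E → V → Set
  Incident e v = proj₁ (ends e) ≡ v ⊎ proj₂ (ends e) ≡ v

  IsLink : E → Set
  IsLink e = proj₁ (ends e) ≢ proj₂ (ends e)

  δ : V → Set
  δ u = Σ[ e ∈ E ] (IsLink e × Incident e u)

  next : ∀ {k} → Fin (suc k) → Fin (suc k)
  next {k} i = suc (toℕ i) mod suc k

  -- An edge set S is a cycle: there are L = suc k ≥ 1 distinct vertices
  -- v_0..v_{L-1} and distinct edges e_0..e_{L-1} with e_i joining v_i and
  -- v_{i+1 mod L}, and S is exactly {e_0,...,e_{L-1}}.
  -- (L = 1: a loop; L = 2: two parallel links.)
  IsCycle : Subset m → Set
  IsCycle S =
    Σ[ k ∈ ℕ ] Σ[ vs ∈ (Fin (suc k) → V) ] Σ[ es ∈ (Fin (suc k) → E) ]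
      (Injective _≡_ _≡_ vs × Injective _≡_ _≡_ es
       × (∀ i → Joins (es i) (vs i) (vs (next i)))
       × (∀ e → (e ∈ S → ∃[ i ] es i ≡ e) × (∃[ i ] es i ≡ e → e ∈ S)))

  ContainsVertex : Subset m → V → Set
  ContainsVertex S v = ∃[ e ] (e ∈ S × Incident e v)

  record Path (x y : V) : Set where
    field
      k     : ℕ
      vs    : Fin (suc (suc k)) → V
      es    : Fin (suc k) → E
      vs-inj : Injective _≡_ _≡_ vs
      es-inj : Injective _≡_ _≡_ es
      step  : ∀ i → Joins (es i) (vs (inject₁ i)) (vs (suc i))
      start : vs zero ≡ x
      end   : vs (fromℕ (suc k)) ≡ y

  edgeSet : ∀ {x y} → Path x y → Subset m
  edgeSet P = tabulate λ e → ⌊ any? (λ i → Path.es P i ≟ e) ⌋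

  InternallyDisjoint : ∀ {x y} → Path x y → Path x y → Set
  InternallyDisjoint {x} {y} P Q =
    (∀ i j → Path.es P i ≢ Path.es Q j)
    × (∀ i j → Path.vs P i ≡ Path.vs Q j → Path.vs P i ≡ x ⊎ Path.vs P i ≡ y)

  -- A biased graph: a collection 𝓑 (given by its characteristic function
  -- on edge sets) of cycles, such that no theta subgraph contains exactly
  -- two balanced cycles. A theta subgraph is the union of three internally
  -- disjoint paths P₁,P₂,P₃ between distinct vertices x,y; its cycles are
  -- P₁∪P₂, P₁∪P₃, P₂∪P₃ (all orderings are quantified over).
  Balanced : (Subset m → Bool) → Subset m → Set
  Balanced 𝓑 S = 𝓑 S ≡ true

  IsBiased : (Subset m → Bool) → Set
  IsBiased 𝓑 =
    (∀ S → Balanced 𝓑 S → IsCycle S)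
    × (∀ x y → x ≢ y → (P₁ P₂ P₃ : Path x y)
        → InternallyDisjoint P₁ P₂ → InternallyDisjoint P₁ P₃
        → InternallyDisjoint P₂ P₃
        → ¬ ( Balanced 𝓑 (edgeSet P₁ ∪ edgeSet P₂)
            × Balanced 𝓑 (edgeSet P₁ ∪ edgeSet P₃)
            × ¬ Balanced 𝓑 (edgeSet P₂ ∪ edgeSet P₃)))

  -- u is balancing: every cycle of G − u (i.e. every cycle of G not
  -- meeting u) is balanced
  IsBalancingVertex : (Subset m → Bool) → V → Set
  IsBalancingVertex 𝓑 u =
    ∀ S → IsCycle S → ¬ ContainsVertex S u → Balanced 𝓑 S

-- Call two links at u related when they are equal or lie together on a balanced
-- cycle.  The heart of the proof is that the balance of a cycle through u depends
-- only on its two edges at u: if e P f and e P′ f are such cycles, P can be rerouted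
-- onto P′ one edge at a time, and each step exchanges a subpath of P for one of P′
-- across a theta graph in which the cycle formed by the two subpaths avoids u, hence
-- is balanced, so the theta property carries balance over.  Transitivity is one
-- more theta argument: for balanced cycles e P f and f Q g, the first vertex x of P
-- on Q cuts out a theta graph between u and x; its cycle through e and f is
-- balanced by the first step and its cycle through f and g is part of f Q g, so the
-- remaining cycle, through e and g, is balanced too.

module Submission where

open import Defs
open import Level using (0ℓ)
open import Function using (_∘_; _$_)
open import Data.Empty using (⊥-elim)
open import Data.Bool using (Bool; true)
import Data.Bool as Bool
open import Data.Nat using (ℕ; zero; suc; s<s)
open import Data.Nat.DivMod using (_%_; n%n≡0; m<n⇒m%n≡m)
open import Data.Fin using (Fin; zero; suc; _≟_; inject₁; fromℕ; toℕ)
open import Data.Fin.Properties using (any?; toℕ-injective; toℕ-fromℕ<; toℕ-fromℕ; toℕ-inject₁; toℕ<n)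
open import Data.Fin.Subset using (Subset; _∈_; _∪_)
open import Data.Fin.Subset.Properties using (⊆-antisym; x∈p∪q⁺; x∈p∪q⁻)
open import Data.Vec using (tabulate)
open import Data.Vec.Properties using ([]=⇒lookup; lookup⇒[]=; lookup∘tabulate)
open import Data.Product using (Σ-syntax; ∃-syntax; _×_; _,_; proj₁; proj₂)
open import Data.Sum using (_⊎_; inj₁; inj₂; [_,_]′)
import Data.Sum
open import Data.List using (List; []; _∷_; _++_; [_]; reverse)
import Data.List as List
open import Data.List.Properties using (unfold-reverse; ++-assoc)
open import Data.List.Membership.Propositional using () renaming (_∈_ to _∈ₗ_; _∉_ to _∉ₗ_)
open import Data.List.Membership.Propositional.Properties
  using (∈-++⁺ˡ; ∈-++⁺ʳ; ∈-++⁻; ∈-tabulate⁺; ∈-tabulate⁻)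
open import Data.List.Relation.Unary.Any using (here; there)
import Data.List.Relation.Unary.Any.Properties as Any
open import Data.List.Relation.Unary.All as All using ([]; _∷_)
import Data.List.Relation.Unary.All.Properties as Allₚ
open import Data.List.Relation.Unary.Unique.Propositional using (Unique; []; _∷_)
open import Data.List.Relation.Unary.Unique.Propositional.Properties using (Unique[x∷xs]⇒x∉xs)
import Data.List.Relation.Unary.Unique.Propositional.Properties as Unique
open import Data.List.Relation.Binary.Disjoint.Propositional using (Disjoint)
open import Data.List.Relation.Binary.Permutation.Propositional
  using (_↭_; ↭-refl; ↭-sym; ↭⇒↭ₛ; module PermutationReasoning)
open import Data.List.Relation.Binary.Permutation.Propositional.Properties
  using (∈-resp-↭; ↭-reverse; ++⁺ˡ; ++⁺ʳ; ++-commutativeMonoid)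
import Data.List.Relation.Binary.Permutation.Setoid.Properties as Permutationₛ
import Algebra.Solver.CommutativeMonoid as CommutativeMonoidSolver
open import Relation.Nullary using (¬_; Dec; yes; no)
open import Relation.Nullary.Decidable using (⌊_⌋)
open import Relation.Binary using (Rel; IsEquivalence; _Respects_)
open import Relation.Binary.PropositionalEquality
  using (_≡_; _≢_; refl; sym; trans; cong; cong₂; subst; setoid; module ≡-Reasoning)

module _ {A : Set} where

  Unique-resp-↭ : Unique {A = A} Respects _↭_
  Unique-resp-↭ p = Permutationₛ.Unique-resp-↭ (setoid A) (↭⇒↭ₛ p)

  Unique-∷⁺ : ∀ {x : A} {xs} → x ∉ₗ xs → Unique xs → Unique (x ∷ xs)
  Unique-∷⁺ {xs = xs} x∉xs xs! = Allₚ.¬Any⇒All¬ xs x∉xs ∷ xs!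

  Unique-++⁻ˡ : ∀ (xs : List A) {ys} → Unique (xs ++ ys) → Unique xs
  Unique-++⁻ˡ []       _            = []
  Unique-++⁻ˡ (x ∷ xs) (x∉ ∷ xys!) = Allₚ.++⁻ˡ xs x∉ ∷ Unique-++⁻ˡ xs xys!

  Unique-++⁻ʳ : ∀ (xs : List A) {ys} → Unique (xs ++ ys) → Unique ys
  Unique-++⁻ʳ []       ys!          = ys!
  Unique-++⁻ʳ (x ∷ xs) (_ ∷ xys!) = Unique-++⁻ʳ xs xys!

  Unique-++⁻-disjoint : ∀ (xs : List A) {ys} → Unique (xs ++ ys) → Disjoint xs ys
  Unique-++⁻-disjoint (x ∷ xs) (x∉ ∷ _) (here refl , v∈ys) = All.lookup (Allₚ.++⁻ʳ xs x∉) v∈ys refl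
  Unique-++⁻-disjoint (x ∷ xs) (_ ∷ xys!) (there v∈xs , v∈ys) = Unique-++⁻-disjoint xs xys! (v∈xs , v∈ys)

  Unique-reverse⁺ : ∀ {xs : List A} → Unique xs → Unique (reverse xs)
  Unique-reverse⁺ {xs} = Unique-resp-↭ (↭-sym (↭-reverse xs))

  tabulate-unique⇒injective : ∀ {n} (f : Fin n → A) → Unique (List.tabulate f) → ∀ {i j} → f i ≡ f j → i ≡ j
  tabulate-unique⇒injective f _ {zero} {zero} _ = refl
  tabulate-unique⇒injective f f! {zero} {suc j} eq =
    ⊥-elim (Unique[x∷xs]⇒x∉xs f! (subst (_∈ₗ List.tabulate (f ∘ suc)) (sym eq) (∈-tabulate⁺ j)))
  tabulate-unique⇒injective f f! {suc i} {zero} eq =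
    ⊥-elim (Unique[x∷xs]⇒x∉xs f! (subst (_∈ₗ List.tabulate (f ∘ suc)) eq (∈-tabulate⁺ i)))
  tabulate-unique⇒injective f (_ ∷ f!) {suc i} {suc j} eq = cong suc (tabulate-unique⇒injective (f ∘ suc) f! eq)

  tabulate-∷ʳ : ∀ {n} (f : Fin (suc n) → A) → List.tabulate (f ∘ inject₁) ++ [ f (fromℕ n) ] ≡ List.tabulate f
  tabulate-∷ʳ {zero}  f = refl
  tabulate-∷ʳ {suc n} f = cong (f zero ∷_) (tabulate-∷ʳ (f ∘ suc))

last-or-inject₁ : ∀ {k} (i : Fin (suc k)) → i ≡ fromℕ k ⊎ ∃[ j ] i ≡ inject₁ j
last-or-inject₁ {zero}  zero    = inj₁ refl
last-or-inject₁ {suc k} zero    = inj₂ (zero , refl)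
last-or-inject₁ {suc k} (suc i) with last-or-inject₁ i
... | inj₁ refl      = inj₁ refl
... | inj₂ (j , refl) = inj₂ (suc j , refl)

module _ {A : Set} where
  open CommutativeMonoidSolver (++-commutativeMonoid {A = A}) public using (solve; _⊕_; _⊜_)

module _ {m : ℕ} {P : Fin m → Set} (P? : ∀ i → Dec (P i)) where

  ∈-tabulate-dec⁺ : ∀ {i} → P i → i ∈ tabulate (λ j → ⌊ P? j ⌋)
  ∈-tabulate-dec⁺ {i} p = lookup⇒[]= i _ (trans (lookup∘tabulate _ i) (true-if-yes (P? i)))
    where
    true-if-yes : (d : Dec (P i)) → ⌊ d ⌋ ≡ true
    true-if-yes (yes _) = refl
    true-if-yes (no ¬p) = ⊥-elim (¬p p)

  ∈-tabulate-dec⁻ : ∀ {i} → i ∈ tabulate (λ j → ⌊ P? j ⌋) → P i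
  ∈-tabulate-dec⁻ {i} i∈ = witness (P? i) (trans (sym (lookup∘tabulate _ i)) ([]=⇒lookup i∈))
    where
    witness : (d : Dec (P i)) → ⌊ d ⌋ ≡ true → P i
    witness (yes p) _ = p
    witness (no _) ()

module _ {m : ℕ} where
  open import Data.List.Membership.DecPropositional (_≟_ {m}) using (_∈?_)

  toSubset : List (Fin m) → Subset m
  toSubset xs = tabulate (λ e → ⌊ e ∈? xs ⌋)

  ∈-toSubset⁺ : ∀ {xs e} → e ∈ₗ xs → e ∈ toSubset xs
  ∈-toSubset⁺ {xs} = ∈-tabulate-dec⁺ (_∈? xs)

  ∈-toSubset⁻ : ∀ {xs e} → e ∈ toSubset xs → e ∈ₗ xs
  ∈-toSubset⁻ {xs} = ∈-tabulate-dec⁻ (_∈? xs)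

  toSubset-cong : ∀ {xs ys} → (∀ {e} → e ∈ₗ xs → e ∈ₗ ys) → (∀ {e} → e ∈ₗ ys → e ∈ₗ xs) →
                  toSubset xs ≡ toSubset ys
  toSubset-cong xs⊆ys ys⊆xs =
    ⊆-antisym (∈-toSubset⁺ ∘ xs⊆ys ∘ ∈-toSubset⁻) (∈-toSubset⁺ ∘ ys⊆xs ∘ ∈-toSubset⁻)

  toSubset-resp-↭ : ∀ {xs ys} → xs ↭ ys → toSubset xs ≡ toSubset ys
  toSubset-resp-↭ xs↭ys = toSubset-cong (∈-resp-↭ xs↭ys) (∈-resp-↭ (↭-sym xs↭ys))

  toSubset-++ : ∀ xs ys → toSubset (xs ++ ys) ≡ toSubset xs ∪ toSubset ys
  toSubset-++ xs ys = ⊆-antisym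
    (x∈p∪q⁺ ∘ Data.Sum.map ∈-toSubset⁺ ∈-toSubset⁺ ∘ ∈-++⁻ xs ∘ ∈-toSubset⁻)
    (∈-toSubset⁺ ∘ [ ∈-++⁺ˡ ∘ ∈-toSubset⁻ , ∈-++⁺ʳ xs ∘ ∈-toSubset⁻ ]′ ∘ x∈p∪q⁻ _ _)

module _ (G : Graph) where

  private variable
    a b x y z v : V G
    e : E G

  Joins-sym : Joins G e x y → Joins G e y x
  Joins-sym (inj₁ p) = inj₂ p
  Joins-sym (inj₂ p) = inj₁ p

  Joins⇒Incidentˡ : Joins G e x y → Incident G e x
  Joins⇒Incidentˡ (inj₁ p) rewrite p = inj₁ refl
  Joins⇒Incidentˡ (inj₂ p) rewrite p = inj₂ refl

  Joins⇒Incidentʳ : Joins G e x y → Incident G e y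
  Joins⇒Incidentʳ = Joins⇒Incidentˡ ∘ Joins-sym

  Joins-Incident : Joins G e x y → Incident G e v → v ≡ x ⊎ v ≡ y
  Joins-Incident (inj₁ p) (inj₁ q) rewrite p = inj₁ (sym q)
  Joins-Incident (inj₁ p) (inj₂ q) rewrite p = inj₂ (sym q)
  Joins-Incident (inj₂ p) (inj₁ q) rewrite p = inj₂ (sym q)
  Joins-Incident (inj₂ p) (inj₂ q) rewrite p = inj₁ (sym q)

  Joins-functional : Joins G e x y → Joins G e x z → y ≡ z
  Joins-functional (inj₁ p) (inj₁ q) = cong proj₂ (trans (sym p) q)
  Joins-functional (inj₁ p) (inj₂ q) = trans (cong proj₂ (trans (sym p) q)) (cong proj₁ (trans (sym p) q))
  Joins-functional (inj₂ p) (inj₁ q) = trans (cong proj₁ (trans (sym p) q)) (cong proj₂ (trans (sym p) q))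
  Joins-functional (inj₂ p) (inj₂ q) = cong proj₁ (trans (sym p) q)

  Joins⇒IsLink : Joins G e x y → x ≢ y → IsLink G e
  Joins⇒IsLink (inj₁ p) x≢y rewrite p = x≢y
  Joins⇒IsLink (inj₂ p) x≢y rewrite p = x≢y ∘ sym

  Joins-self⇒¬IsLink : Joins G e x x → ¬ IsLink G e
  Joins-self⇒¬IsLink (inj₁ p) link rewrite p = link refl
  Joins-self⇒¬IsLink (inj₂ p) link rewrite p = link refl

  data Walk : V G → V G → Set where
    nil  : Walk x x
    cons : ∀ e → Joins G e x y → Walk y z → Walk x z

  tail-vertices : Walk x y → List (V G)
  tail-vertices nil                  = []
  tail-vertices (cons {y = y} _ _ w) = y ∷ tail-vertices w

  vertices : Walk x y → List (V G)
  vertices {x} w = x ∷ tail-vertices w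

  edges : Walk x y → List (E G)
  edges nil          = []
  edges (cons e _ w) = e ∷ edges w

  infixr 5 _++ʷ_
  _++ʷ_ : Walk x y → Walk y z → Walk x z
  nil          ++ʷ w′ = w′
  cons e j w   ++ʷ w′ = cons e j (w ++ʷ w′)

  reverseʷ : Walk x y → Walk y x
  reverseʷ nil          = nil
  reverseʷ (cons e j w) = reverseʷ w ++ʷ cons e (Joins-sym j) nil

  tail-vertices-++ʷ : (w : Walk x y) (w′ : Walk y z) →
                      tail-vertices (w ++ʷ w′) ≡ tail-vertices w ++ tail-vertices w′
  tail-vertices-++ʷ nil          w′ = refl
  tail-vertices-++ʷ (cons e j w) w′ = cong (_ ∷_) (tail-vertices-++ʷ w w′)

  vertices-++ʷ : (w : Walk x y) (w′ : Walk y z) → vertices (w ++ʷ w′) ≡ vertices w ++ tail-vertices w′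
  vertices-++ʷ w w′ = cong (_ ∷_) (tail-vertices-++ʷ w w′)

  edges-++ʷ : (w : Walk x y) (w′ : Walk y z) → edges (w ++ʷ w′) ≡ edges w ++ edges w′
  edges-++ʷ nil          w′ = refl
  edges-++ʷ (cons e j w) w′ = cong (e ∷_) (edges-++ʷ w w′)

  vertices-reverseʷ : (w : Walk x y) → vertices (reverseʷ w) ≡ reverse (vertices w)
  vertices-reverseʷ nil = refl
  vertices-reverseʷ {x} (cons e j w) = begin
    vertices (reverseʷ w ++ʷ cons e (Joins-sym j) nil) ≡⟨ vertices-++ʷ (reverseʷ w) _ ⟩
    vertices (reverseʷ w) ++ [ x ]                     ≡⟨ cong (_++ [ x ]) (vertices-reverseʷ w) ⟩
    reverse (vertices w) ++ [ x ]                      ≡⟨ unfold-reverse x (vertices w) ⟨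
    reverse (x ∷ vertices w)                           ∎
    where open ≡-Reasoning

  edges-reverseʷ : (w : Walk x y) → edges (reverseʷ w) ≡ reverse (edges w)
  edges-reverseʷ nil = refl
  edges-reverseʷ (cons e j w) = begin
    edges (reverseʷ w ++ʷ cons e (Joins-sym j) nil) ≡⟨ edges-++ʷ (reverseʷ w) _ ⟩
    edges (reverseʷ w) ++ [ e ]                     ≡⟨ cong (_++ [ e ]) (edges-reverseʷ w) ⟩
    reverse (edges w) ++ [ e ]                      ≡⟨ unfold-reverse e (edges w) ⟨
    reverse (e ∷ edges w)                           ∎
    where open ≡-Reasoning

  end∈vertices : (w : Walk x y) → y ∈ₗ vertices w
  end∈vertices nil          = here refl
  end∈vertices (cons e j w) = there (end∈vertices w)

  ∈-vertices-++ʷ⁺ˡ : (w : Walk x y) (w′ : Walk y z) → v ∈ₗ vertices w → v ∈ₗ vertices (w ++ʷ w′)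
  ∈-vertices-++ʷ⁺ˡ {v = v} w w′ v∈w = subst (v ∈ₗ_) (sym (vertices-++ʷ w w′)) (∈-++⁺ˡ v∈w)

  ∈-vertices-++ʷ⁺ʳ : (w : Walk x y) (w′ : Walk y z) → v ∈ₗ vertices w′ → v ∈ₗ vertices (w ++ʷ w′)
  ∈-vertices-++ʷ⁺ʳ w w′ (here refl) = ∈-vertices-++ʷ⁺ˡ w w′ (end∈vertices w)
  ∈-vertices-++ʷ⁺ʳ {v = v} w w′ (there v∈w′) = subst (v ∈ₗ_) (sym (vertices-++ʷ w w′)) (∈-++⁺ʳ (vertices w) v∈w′)

  ∈-vertices-++ʷ⁻ : (w : Walk x y) (w′ : Walk y z) → v ∈ₗ vertices (w ++ʷ w′) →
                    v ∈ₗ vertices w ⊎ v ∈ₗ tail-vertices w′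
  ∈-vertices-++ʷ⁻ {v = v} w w′ = ∈-++⁻ (vertices w) ∘ subst (v ∈ₗ_) (vertices-++ʷ w w′)

  ∈-edges-++ʷ⁺ˡ : (w : Walk x y) (w′ : Walk y z) → e ∈ₗ edges w → e ∈ₗ edges (w ++ʷ w′)
  ∈-edges-++ʷ⁺ˡ {e = e} w w′ = subst (e ∈ₗ_) (sym (edges-++ʷ w w′)) ∘ ∈-++⁺ˡ

  ∈-edges-++ʷ⁺ʳ : (w : Walk x y) (w′ : Walk y z) → e ∈ₗ edges w′ → e ∈ₗ edges (w ++ʷ w′)
  ∈-edges-++ʷ⁺ʳ {e = e} w w′ = subst (e ∈ₗ_) (sym (edges-++ʷ w w′)) ∘ ∈-++⁺ʳ (edges w)

  ∈-edges-++ʷ⁻ : (w : Walk x y) (w′ : Walk y z) → e ∈ₗ edges (w ++ʷ w′) → e ∈ₗ edges w ⊎ e ∈ₗ edges w′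
  ∈-edges-++ʷ⁻ {e = e} w w′ = ∈-++⁻ (edges w) ∘ subst (e ∈ₗ_) (edges-++ʷ w w′)

  ∈-vertices-reverseʷ⁻ : (w : Walk x y) → v ∈ₗ vertices (reverseʷ w) → v ∈ₗ vertices w
  ∈-vertices-reverseʷ⁻ {v = v} w = Any.reverse⁻ ∘ subst (v ∈ₗ_) (vertices-reverseʷ w)

  ∈-edges-reverseʷ⁻ : (w : Walk x y) → e ∈ₗ edges (reverseʷ w) → e ∈ₗ edges w
  ∈-edges-reverseʷ⁻ {e = e} w = Any.reverse⁻ ∘ subst (e ∈ₗ_) (edges-reverseʷ w)

  ∈-vertices-incident : (w : Walk x y) → e ∈ₗ edges w → Incident G e v → v ∈ₗ vertices w
  ∈-vertices-incident (cons e j w) (here refl) inc with Joins-Incident j inc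
  ... | inj₁ refl = here refl
  ... | inj₂ refl = there (here refl)
  ∈-vertices-incident (cons e j w) (there e∈w) inc = there (∈-vertices-incident w e∈w inc)

  splitAt : (w : Walk x z) → v ∈ₗ vertices w → Σ[ w₁ ∈ Walk x v ] Σ[ w₂ ∈ Walk v z ] w₁ ++ʷ w₂ ≡ w
  splitAt w            (here refl)  = nil , w , refl
  splitAt (cons e j w) (there v∈w) with splitAt w v∈w
  ... | w₁ , w₂ , refl = cons e j w₁ , w₂ , refl

  record SplitAtFirst (P : V G → Set) (w : Walk x z) : Set where
    field
      {meet}  : V G
      prefix  : Walk x meet
      suffix  : Walk meet z
      split   : prefix ++ʷ suffix ≡ w
      P-meet  : P meet
      first   : ∀ {t} → t ∈ₗ vertices prefix → P t → t ≡ meet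

  splitAtFirst : {P : V G → Set} → (∀ t → Dec (P t)) → (w : Walk x z) → P z → SplitAtFirst P w
  splitAtFirst {x = x} P? w Pz with P? x
  ... | yes Px = record { prefix = nil ; suffix = w ; split = refl ; P-meet = Px ; first = λ { (here refl) _ → refl } }
  splitAtFirst P? nil Pz | no ¬Px = ⊥-elim (¬Px Pz)
  splitAtFirst P? (cons e j w) Pz | no ¬Px = record
    { prefix = cons e j prefix ; suffix = suffix ; split = cong (cons e j) split ; P-meet = P-meet
    ; first  = λ { (here refl) Pt → ⊥-elim (¬Px Pt) ; (there t∈) Pt → first t∈ Pt } }
    where open SplitAtFirst (splitAtFirst P? w Pz)

  IsPath : Walk x y → Set
  IsPath w = Unique (vertices w) × Unique (edges w)

  MeetOnlyAt : V G → V G → Walk a b → Walk z v → Set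
  MeetOnlyAt x y w w′ = (∀ {t} → t ∈ₗ vertices w → t ∈ₗ vertices w′ → t ≡ x ⊎ t ≡ y) × Disjoint (edges w) (edges w′)

  InternallyDisjointʷ : Walk x y → Walk a b → Set
  InternallyDisjointʷ {x} {y} = MeetOnlyAt x y

  IsPath-cons⁻ : ∀ {j : Joins G e x y} {w : Walk y z} → IsPath (cons e j w) → IsPath w
  IsPath-cons⁻ (_ ∷ vs! , _ ∷ es!) = vs! , es!

  IsPath-cons⁺ : (j : Joins G e x y) (w : Walk y z) → x ∉ₗ vertices w → IsPath w → IsPath (cons e j w)
  IsPath-cons⁺ j w x∉w (vs! , es!) =
    Unique-∷⁺ x∉w vs! , Unique-∷⁺ (λ e∈w → x∉w (∈-vertices-incident w e∈w (Joins⇒Incidentˡ j))) es!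

  record IsPathSplit (w₁ : Walk x y) (w₂ : Walk y z) : Set where
    field
      prefix-isPath     : IsPath w₁
      suffix-isPath     : IsPath w₂
      vertices-disjoint : Disjoint (vertices w₁) (tail-vertices w₂)
      edges-disjoint    : Disjoint (edges w₁) (edges w₂)

  IsPath-++ʷ⁻ : (w₁ : Walk x y) (w₂ : Walk y z) → IsPath (w₁ ++ʷ w₂) → IsPathSplit w₁ w₂
  IsPath-++ʷ⁻ w₁ w₂ (vs! , es!) = record
    { prefix-isPath     = Unique-++⁻ˡ (vertices w₁) vs!′ , Unique-++⁻ˡ (edges w₁) es!′
    ; suffix-isPath     = Unique-∷⁺ (λ y∈ → vs-disjoint (end∈vertices w₁ , y∈)) (Unique-++⁻ʳ (vertices w₁) vs!′)
                        , Unique-++⁻ʳ (edges w₁) es!′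
    ; vertices-disjoint = vs-disjoint
    ; edges-disjoint    = Unique-++⁻-disjoint (edges w₁) es!′
    }
    where
    vs!′ : Unique (vertices w₁ ++ tail-vertices w₂)
    vs!′ = subst Unique (vertices-++ʷ w₁ w₂) vs!
    es!′ : Unique (edges w₁ ++ edges w₂)
    es!′ = subst Unique (edges-++ʷ w₁ w₂) es!
    vs-disjoint : Disjoint (vertices w₁) (tail-vertices w₂)
    vs-disjoint = Unique-++⁻-disjoint (vertices w₁) vs!′

  IsPath-++ʷ⁺ : (w₁ : Walk x y) (w₂ : Walk y z) → IsPath w₁ → IsPath w₂ →
                Disjoint (vertices w₁) (tail-vertices w₂) → Disjoint (edges w₁) (edges w₂) → IsPath (w₁ ++ʷ w₂)
  IsPath-++ʷ⁺ w₁ w₂ (vs₁! , es₁!) (_ ∷ vs₂! , es₂!) vs-disjoint es-disjoint =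
      subst Unique (sym (vertices-++ʷ w₁ w₂)) (Unique.++⁺ vs₁! vs₂! vs-disjoint)
    , subst Unique (sym (edges-++ʷ w₁ w₂)) (Unique.++⁺ es₁! es₂! es-disjoint)

  IsPath-reverseʷ : (w : Walk x y) → IsPath w → IsPath (reverseʷ w)
  IsPath-reverseʷ w (vs! , es!) =
      subst Unique (sym (vertices-reverseʷ w)) (Unique-reverse⁺ vs!)
    , subst Unique (sym (edges-reverseʷ w)) (Unique-reverse⁺ es!)

  IsPath-++ʷ-reverseʷ : (A : Walk a x) (B : Walk b x) → IsPath A → IsPath B →
    (∀ {t} → t ∈ₗ vertices A → t ∈ₗ vertices B → t ≡ x) → Disjoint (edges A) (edges B) →
    IsPath (A ++ʷ reverseʷ B)
  IsPath-++ʷ-reverseʷ A B A-path B-path meet disjoint =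
    IsPath-++ʷ⁺ A (reverseʷ B) A-path B⁻-path vertices-disjoint
      (λ (e∈A , e∈B⁻) → disjoint (e∈A , ∈-edges-reverseʷ⁻ B e∈B⁻))
    where
    B⁻-path : IsPath (reverseʷ B)
    B⁻-path = IsPath-reverseʷ B B-path
    vertices-disjoint : Disjoint (vertices A) (tail-vertices (reverseʷ B))
    vertices-disjoint (t∈A , t∈B⁻) with meet t∈A (∈-vertices-reverseʷ⁻ B (there t∈B⁻))
    ... | refl = Unique[x∷xs]⇒x∉xs (proj₁ B⁻-path) t∈B⁻

  ∈-edges⇒IsLink : (w : Walk x y) → Unique (vertices w) → e ∈ₗ edges w → IsLink G e
  ∈-edges⇒IsLink (cons e j w) vs! (here refl) =
    Joins⇒IsLink j λ { refl → Unique[x∷xs]⇒x∉xs vs! (here refl) }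
  ∈-edges⇒IsLink (cons e j w) (_ ∷ vs!) (there e∈w) = ∈-edges⇒IsLink w vs! e∈w

  closed-path-edges : (w : Walk x x) → Unique (vertices w) → edges w ≡ []
  closed-path-edges nil          _   = refl
  closed-path-edges (cons e j w) vs! = ⊥-elim (Unique[x∷xs]⇒x∉xs vs! (end∈vertices w))

  -- An edge shared by w and w′ would have both ends at y, but it is a link.
  meets-at-end⇒edges-disjoint : (w : Walk x y) (w′ : Walk a b) → Unique (vertices w) →
    (∀ {t} → t ∈ₗ vertices w → t ∈ₗ vertices w′ → t ≡ y) → Disjoint (edges w) (edges w′)
  meets-at-end⇒edges-disjoint w w′ vs! meet-at-y {e} (e∈w , e∈w′) =
    ∈-edges⇒IsLink w vs! e∈w (trans (end-at-y (inj₁ refl)) (sym (end-at-y (inj₂ refl))))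
    where
    end-at-y : ∀ {t} → Incident G e t → t ≡ _
    end-at-y inc = meet-at-y (∈-vertices-incident w e∈w inc) (∈-vertices-incident w′ e∈w′ inc)

  length : Walk x y → ℕ
  length nil          = zero
  length (cons _ _ w) = suc (length w)

  vertexAt : (w : Walk x y) → Fin (suc (length w)) → V G
  vertexAt {x} w            zero    = x
  vertexAt     (cons e j w) (suc i) = vertexAt w i

  edgeAt : (w : Walk x y) → Fin (length w) → E G
  edgeAt (cons e j w) zero    = e
  edgeAt (cons e j w) (suc i) = edgeAt w i

  vertices-tabulate : (w : Walk x y) → vertices w ≡ List.tabulate (vertexAt w)
  vertices-tabulate nil          = refl
  vertices-tabulate {x} (cons e j w) = cong (x ∷_) (vertices-tabulate w)

  edges-tabulate : (w : Walk x y) → edges w ≡ List.tabulate (edgeAt w)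
  edges-tabulate nil          = refl
  edges-tabulate (cons e j w) = cong (e ∷_) (edges-tabulate w)

  vertexAt∈vertices : (w : Walk x y) → ∀ i → vertexAt w i ∈ₗ vertices w
  vertexAt∈vertices w i = subst (vertexAt w i ∈ₗ_) (sym (vertices-tabulate w)) (∈-tabulate⁺ {f = vertexAt w} i)

  edgeAt∈edges : (w : Walk x y) → ∀ i → edgeAt w i ∈ₗ edges w
  edgeAt∈edges w i = subst (edgeAt w i ∈ₗ_) (sym (edges-tabulate w)) (∈-tabulate⁺ {f = edgeAt w} i)

  edgeAt-joins : (w : Walk x y) → ∀ i → Joins G (edgeAt w i) (vertexAt w (inject₁ i)) (vertexAt w (suc i))
  edgeAt-joins (cons e j w) zero    = j
  edgeAt-joins (cons e j w) (suc i) = edgeAt-joins w i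

  vertexAt-last : (w : Walk x y) → vertexAt w (fromℕ (length w)) ≡ y
  vertexAt-last nil          = refl
  vertexAt-last (cons e j w) = vertexAt-last w

  toPath : x ≢ y → (w : Walk x y) → IsPath w → Path G x y
  toPath x≢y nil          _           = ⊥-elim (x≢y refl)
  toPath x≢y (cons e j w) (vs! , es!) = record
    { k      = length w
    ; vs     = vertexAt (cons e j w)
    ; es     = edgeAt (cons e j w)
    ; vs-inj = tabulate-unique⇒injective _ (subst Unique (vertices-tabulate (cons e j w)) vs!)
    ; es-inj = tabulate-unique⇒injective _ (subst Unique (edges-tabulate (cons e j w)) es!)
    ; step   = edgeAt-joins (cons e j w)
    ; start  = refl
    ; end    = vertexAt-last (cons e j w)
    }

  edgeSet-toPath : (x≢y : x ≢ y) (w : Walk x y) (p : IsPath w) → edgeSet G (toPath x≢y w p) ≡ toSubset (edges w)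
  edgeSet-toPath x≢y nil            _ = ⊥-elim (x≢y refl)
  edgeSet-toPath x≢y w@(cons _ _ _) _ = ⊆-antisym
    (λ e∈ → let i , eq = ∈-tabulate-dec⁻ edgeAt? e∈
            in ∈-toSubset⁺ (subst (_∈ₗ edges w) eq (edgeAt∈edges w i)))
    (λ {e} e∈ → let i , eq = ∈-tabulate⁻ {f = edgeAt w} (subst (e ∈ₗ_) (edges-tabulate w) (∈-toSubset⁻ e∈))
            in ∈-tabulate-dec⁺ edgeAt? (i , sym eq))
    where
    edgeAt? : ∀ e → Dec (∃[ i ] edgeAt w i ≡ e)
    edgeAt? e = any? (λ i → edgeAt w i ≟ e)

  InternallyDisjoint-toPath : (x≢y : x ≢ y) (w w′ : Walk x y) (p : IsPath w) (p′ : IsPath w′) →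
    InternallyDisjointʷ w w′ → InternallyDisjoint G (toPath x≢y w p) (toPath x≢y w′ p′)
  InternallyDisjoint-toPath x≢y nil _ _ _ _ = ⊥-elim (x≢y refl)
  InternallyDisjoint-toPath x≢y (cons _ _ _) nil _ _ _ = ⊥-elim (x≢y refl)
  InternallyDisjoint-toPath x≢y w@(cons _ _ _) w′@(cons _ _ _) _ _ (meet , es-disjoint) =
      (λ i i′ eq → es-disjoint (edgeAt∈edges w i , subst (_∈ₗ edges w′) (sym eq) (edgeAt∈edges w′ i′)))
    , (λ i i′ eq → meet (vertexAt∈vertices w i) (subst (_∈ₗ vertices w′) (sym eq) (vertexAt∈vertices w′ i′)))

  next-last : ∀ k → next G (fromℕ k) ≡ zero
  next-last k = toℕ-injective (begin
    toℕ (next G (fromℕ k))       ≡⟨ toℕ-fromℕ< _ ⟩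
    suc (toℕ (fromℕ k)) % suc k  ≡⟨ cong (λ t → suc t % suc k) (toℕ-fromℕ k) ⟩
    suc k % suc k                ≡⟨ n%n≡0 (suc k) ⟩
    zero                         ∎)
    where open ≡-Reasoning

  next-inject₁ : ∀ {k} (j : Fin k) → next G (inject₁ j) ≡ suc j
  next-inject₁ {k} j = toℕ-injective (begin
    toℕ (next G (inject₁ j))       ≡⟨ toℕ-fromℕ< _ ⟩
    suc (toℕ (inject₁ j)) % suc k  ≡⟨ cong (λ t → suc t % suc k) (toℕ-inject₁ j) ⟩
    suc (toℕ j) % suc k            ≡⟨ m<n⇒m%n≡m (s<s (toℕ<n j)) ⟩
    suc (toℕ j)                    ∎)
    where open ≡-Reasoning

  tabulateʷ : ∀ k (f : Fin (suc k) → V G) (g : Fin k → E G) →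
              (∀ i → Joins G (g i) (f (inject₁ i)) (f (suc i))) → Walk (f zero) (f (fromℕ k))
  tabulateʷ zero    f g h = nil
  tabulateʷ (suc k) f g h = cons (g zero) (h zero) (tabulateʷ k (f ∘ suc) (g ∘ suc) (h ∘ suc))

  vertices-tabulateʷ : ∀ k f g h → vertices (tabulateʷ k f g h) ≡ List.tabulate f
  vertices-tabulateʷ zero    f g h = refl
  vertices-tabulateʷ (suc k) f g h = cong (f zero ∷_) (vertices-tabulateʷ k (f ∘ suc) (g ∘ suc) (h ∘ suc))

  edges-tabulateʷ : ∀ k f g h → edges (tabulateʷ k f g h) ≡ List.tabulate g
  edges-tabulateʷ zero    f g h = refl
  edges-tabulateʷ (suc k) f g h = cong (g zero ∷_) (edges-tabulateʷ k (f ∘ suc) (g ∘ suc) (h ∘ suc))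

  closedEdgeAt : (w : Walk x y) → E G → Fin (suc (length w)) → E G
  closedEdgeAt nil          g zero    = g
  closedEdgeAt (cons e j w) g zero    = e
  closedEdgeAt (cons e j w) g (suc i) = closedEdgeAt w g i

  closedEdgeAt-last : (w : Walk x y) (g : E G) → closedEdgeAt w g (fromℕ (length w)) ≡ g
  closedEdgeAt-last nil          g = refl
  closedEdgeAt-last (cons e j w) g = closedEdgeAt-last w g

  closedEdgeAt-inject₁ : (w : Walk x y) (g : E G) → ∀ i → closedEdgeAt w g (inject₁ i) ≡ edgeAt w i
  closedEdgeAt-inject₁ (cons e j w) g zero    = refl
  closedEdgeAt-inject₁ (cons e j w) g (suc i) = closedEdgeAt-inject₁ w g i

  closed-edges-tabulate : (w : Walk x y) (g : E G) → edges w ++ [ g ] ≡ List.tabulate (closedEdgeAt w g)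
  closed-edges-tabulate nil          g = refl
  closed-edges-tabulate (cons e j w) g = cong (e ∷_) (closed-edges-tabulate w g)

  record ClosedPath (x : V G) (S : Subset (Graph.m G)) : Set where
    field
      {end}           : V G
      path            : Walk x end
      closing         : E G
      closes          : Joins G closing end x
      vertices-unique : Unique (vertices path)
      edges-unique    : Unique (edges path ++ [ closing ])
      edge-set        : toSubset (edges path ++ [ closing ]) ≡ S

  ClosedPath⇒IsCycle : ∀ {S} → ClosedPath x S → IsCycle G S
  ClosedPath⇒IsCycle {S = S} c =
      length path , vertexAt path , closedEdgeAt path closing
    , tabulate-unique⇒injective _ (subst Unique (vertices-tabulate path) vertices-unique)
    , tabulate-unique⇒injective _ (subst Unique (closed-edges-tabulate path closing) edges-unique)
    , joins
    , λ e → (λ e∈S → let i , eq = ∈-tabulate⁻ {f = closedEdge} (∈-closed e∈S) in i , sym eq)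
          , (λ (i , eq) → subst (_∈ S) eq (∈-S (subst (closedEdge i ∈ₗ_)
                              (sym (closed-edges-tabulate path closing)) (∈-tabulate⁺ {f = closedEdge} i))))
    where
    open ClosedPath c
    closedEdge : Fin (suc (length path)) → E G
    closedEdge = closedEdgeAt path closing
    ∈-S : ∀ {e} → e ∈ₗ edges path ++ [ closing ] → e ∈ S
    ∈-S = subst (_ ∈_) edge-set ∘ ∈-toSubset⁺
    ∈-closed : ∀ {e} → e ∈ S → e ∈ₗ List.tabulate (closedEdgeAt path closing)
    ∈-closed {e} = subst (e ∈ₗ_) (closed-edges-tabulate path closing) ∘ ∈-toSubset⁻ ∘ subst (e ∈_) (sym edge-set)
    joins : ∀ i → Joins G (closedEdgeAt path closing i) (vertexAt path i) (vertexAt path (next G i))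
    joins i with last-or-inject₁ i
    ... | inj₁ refl rewrite next-last (length path) | closedEdgeAt-last path closing | vertexAt-last path = closes
    ... | inj₂ (j , refl) rewrite next-inject₁ j | closedEdgeAt-inject₁ path closing j = edgeAt-joins path j

  IsCycle⇒ClosedPath : ∀ {S} → IsCycle G S → ∃[ x ] ClosedPath x S
  IsCycle⇒ClosedPath {S} (k , vs , es , vs-inj , es-inj , joins , exact) = vs zero , record
    { path            = path
    ; closing         = es (fromℕ k)
    ; closes          = subst (Joins G (es (fromℕ k)) (vs (fromℕ k)) ∘ vs) (next-last k) (joins (fromℕ k))
    ; vertices-unique = subst Unique (sym (vertices-tabulateʷ k vs _ steps)) (Unique.tabulate⁺ vs-inj)
    ; edges-unique    = subst Unique (sym edges≡) (Unique.tabulate⁺ es-inj)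
    ; edge-set        = ⊆-antisym
        (λ e∈ → let i , eq = ∈-tabulate⁻ {f = es} (subst (_ ∈ₗ_) edges≡ (∈-toSubset⁻ e∈))
                in proj₂ (exact _) (i , sym eq))
        (λ e∈S → let i , eq = proj₁ (exact _) e∈S
                 in ∈-toSubset⁺ (subst (_∈ₗ _) eq (subst (es i ∈ₗ_) (sym edges≡) (∈-tabulate⁺ {f = es} i))))
    }
    where
    steps : ∀ i → Joins G (es (inject₁ i)) (vs (inject₁ i)) (vs (suc i))
    steps i = subst (Joins G (es (inject₁ i)) (vs (inject₁ i)) ∘ vs) (next-inject₁ i) (joins (inject₁ i))
    path : Walk (vs zero) (vs (fromℕ k))
    path = tabulateʷ k vs (es ∘ inject₁) steps
    edges≡ : edges path ++ [ es (fromℕ k) ] ≡ List.tabulate es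
    edges≡ = trans (cong (_++ _) (edges-tabulateʷ k vs _ steps)) (tabulate-∷ʳ es)

  data SnocView : Walk x z → Set where
    []   : SnocView (nil {x})
    _∷ʳ_ : (w : Walk x y) (j : Joins G e y z) → SnocView (w ++ʷ cons e j nil)

  snocView : (w : Walk x z) → SnocView w
  snocView nil = []
  snocView (cons e j w) with snocView w
  ... | []       = nil ∷ʳ j
  ... | w′ ∷ʳ j′ = cons e j w′ ∷ʳ j′

  rotate : ∀ {S} (c : ClosedPath x S) → v ∈ₗ vertices (ClosedPath.path c) → ClosedPath v S
  rotate {v = v} c@record { path = path ; closing = g ; closes = jg ; vertices-unique = vs! ; edges-unique = es! ; edge-set = S≡ } v∈
    with splitAt path v∈
  ... | w₁ , w₂ , refl with snocView w₁
  ... | [] = c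
  ... | _∷ʳ_ {e = h} w₁′ jh = record
    { path            = w₂ ++ʷ cons g jg w₁′
    ; closing         = h
    ; closes          = jh
    ; vertices-unique = Unique-resp-↭ vertices↭ vs!
    ; edges-unique    = Unique-resp-↭ edges↭ es!
    ; edge-set        = trans (toSubset-resp-↭ (↭-sym edges↭)) S≡
    }
    where
    open PermutationReasoning
    prefix : Walk _ v
    prefix = w₁′ ++ʷ cons h jh nil
    vertices↭ : vertices (prefix ++ʷ w₂) ↭ vertices (w₂ ++ʷ cons g jg w₁′)
    vertices↭ = begin
      vertices (prefix ++ʷ w₂)                     ≡⟨ vertices-++ʷ prefix w₂ ⟩
      vertices prefix ++ tail-vertices w₂          ≡⟨ cong (_++ tail-vertices w₂) (vertices-++ʷ w₁′ _) ⟩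
      (vertices w₁′ ++ [ v ]) ++ tail-vertices w₂  ↭⟨ solve 3 (λ A u B → (A ⊕ u) ⊕ B ⊜ (u ⊕ B) ⊕ A) ↭-refl
                                                        (vertices w₁′) [ v ] (tail-vertices w₂) ⟩
      vertices w₂ ++ vertices w₁′                  ≡⟨ vertices-++ʷ w₂ (cons g jg w₁′) ⟨
      vertices (w₂ ++ʷ cons g jg w₁′)              ∎
    edges↭ : edges (prefix ++ʷ w₂) ++ [ g ] ↭ edges (w₂ ++ʷ cons g jg w₁′) ++ [ h ]
    edges↭ = begin
      edges (prefix ++ʷ w₂) ++ [ g ]                ≡⟨ cong (_++ [ g ]) (edges-++ʷ prefix w₂) ⟩
      (edges prefix ++ edges w₂) ++ [ g ]           ≡⟨ cong (λ es → (es ++ edges w₂) ++ [ g ]) (edges-++ʷ w₁′ _) ⟩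
      ((edges w₁′ ++ [ h ]) ++ edges w₂) ++ [ g ]   ↭⟨ solve 4 (λ A h B g → ((A ⊕ h) ⊕ B) ⊕ g ⊜ (B ⊕ (g ⊕ A)) ⊕ h) ↭-refl
                                                         (edges w₁′) [ h ] (edges w₂) [ g ] ⟩
      (edges w₂ ++ g ∷ edges w₁′) ++ [ h ]          ≡⟨ cong (_++ [ h ]) (edges-++ʷ w₂ (cons g jg w₁′)) ⟨
      edges (w₂ ++ʷ cons g jg w₁′) ++ [ h ]         ∎

  internally-disjoint⇒IsCycle : (A B : Walk x z) → x ≢ z → IsPath A → IsPath B → InternallyDisjointʷ A B →
                                IsCycle G (toSubset (edges A ++ edges B))
  internally-disjoint⇒IsCycle A nil x≢z _ _ _ = ⊥-elim (x≢z refl)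
  internally-disjoint⇒IsCycle {x} A (cons b j B) x≢z A-path B-path@(x∉B ∷ _ , _) (meet , es-disjoint) =
    ClosedPath⇒IsCycle record
      { path            = A ++ʷ reverseʷ B
      ; closing         = b
      ; closes          = Joins-sym j
      ; vertices-unique = proj₁ (IsPath-++ʷ-reverseʷ A B A-path (IsPath-cons⁻ {j = j} B-path) meet-at-z
                                   (λ (e∈A , e∈B) → es-disjoint (e∈A , there e∈B)))
      ; edges-unique    = Unique-resp-↭ (↭-sym edges↭) (Unique.++⁺ (proj₂ A-path) (proj₂ B-path) es-disjoint)
      ; edge-set        = toSubset-resp-↭ edges↭
      }
    where
    meet-at-z : ∀ {t} → t ∈ₗ vertices A → t ∈ₗ vertices B → t ≡ _
    meet-at-z t∈A t∈B with meet t∈A (there t∈B)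
    ... | inj₁ refl = ⊥-elim (All.lookup x∉B t∈B refl)
    ... | inj₂ t≡z  = t≡z
    edges↭ : edges (A ++ʷ reverseʷ B) ++ [ b ] ↭ edges A ++ b ∷ edges B
    edges↭ = begin
      edges (A ++ʷ reverseʷ B) ++ [ b ]          ≡⟨ cong (_++ [ b ]) (edges-++ʷ A (reverseʷ B)) ⟩
      (edges A ++ edges (reverseʷ B)) ++ [ b ]   ≡⟨ cong (λ es → (edges A ++ es) ++ [ b ]) (edges-reverseʷ B) ⟩
      (edges A ++ reverse (edges B)) ++ [ b ]    ↭⟨ ++⁺ʳ [ b ] (++⁺ˡ (edges A) (↭-reverse (edges B))) ⟩
      (edges A ++ edges B) ++ [ b ]              ↭⟨ solve 3 (λ A B b → (A ⊕ B) ⊕ b ⊜ A ⊕ (b ⊕ B)) ↭-refl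
                                                      (edges A) (edges B) [ b ] ⟩
      edges A ++ b ∷ edges B                     ∎
      where open PermutationReasoning

  MeetOnlyAt-++ʷ⁻ˡ : ∀ {c d} (w₁ : Walk a b) (w₂ : Walk b z) {w′ : Walk c d} →
                      MeetOnlyAt x y (w₁ ++ʷ w₂) w′ → MeetOnlyAt x y w₁ w′
  MeetOnlyAt-++ʷ⁻ˡ w₁ w₂ (meet , disjoint) =
    meet ∘ ∈-vertices-++ʷ⁺ˡ w₁ w₂ , λ (e∈w₁ , e∈w′) → disjoint (∈-edges-++ʷ⁺ˡ w₁ w₂ e∈w₁ , e∈w′)

  MeetOnlyAt-++ʷ⁻ʳ : ∀ {c d} (w₁ : Walk a b) (w₂ : Walk b z) {w′ : Walk c d} →
                      MeetOnlyAt x y (w₁ ++ʷ w₂) w′ → MeetOnlyAt x y w₂ w′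
  MeetOnlyAt-++ʷ⁻ʳ w₁ w₂ (meet , disjoint) =
    meet ∘ ∈-vertices-++ʷ⁺ʳ w₁ w₂ , λ (e∈w₂ , e∈w′) → disjoint (∈-edges-++ʷ⁺ʳ w₁ w₂ e∈w₂ , e∈w′)

  -- The cycle P₁ P₂ R and a path Q₁ from x to z attached to it only at its ends form
  -- a theta graph whose three x–z paths are P₁, Q₁ and C.
  module Handle (P₁ : Walk x z) (P₂ : Walk z y) (R : Walk y x) (x≢z : x ≢ z)
                (P-path : IsPath (P₁ ++ʷ P₂)) (R-path : IsPath R) (PR : InternallyDisjointʷ (P₁ ++ʷ P₂) R) where

    open IsPathSplit (IsPath-++ʷ⁻ P₁ P₂ P-path) public
      renaming (prefix-isPath to P₁-path; suffix-isPath to P₂-path;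
                vertices-disjoint to P₁P₂-vertices; edges-disjoint to P₁P₂-edges)

    P₁R : MeetOnlyAt x y P₁ R
    P₁R = MeetOnlyAt-++ʷ⁻ˡ P₁ P₂ PR

    P₂R : MeetOnlyAt x y P₂ R
    P₂R = MeetOnlyAt-++ʷ⁻ʳ P₁ P₂ PR

    C : Walk x z
    C = reverseʷ (P₂ ++ʷ R)

    x∉P₂ : x ∉ₗ vertices P₂
    x∉P₂ (here x≡z) = x≢z x≡z
    x∉P₂ (there x∈) = P₁P₂-vertices (here refl , x∈)

    ∈C⁻ : ∀ {t} → t ∈ₗ vertices C → t ∈ₗ vertices P₂ ⊎ t ∈ₗ tail-vertices R
    ∈C⁻ = ∈-vertices-++ʷ⁻ P₂ R ∘ ∈-vertices-reverseʷ⁻ (P₂ ++ʷ R)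

    ∈C-edges⁻ : ∀ {e} → e ∈ₗ edges C → e ∈ₗ edges P₂ ⊎ e ∈ₗ edges R
    ∈C-edges⁻ = ∈-edges-++ʷ⁻ P₂ R ∘ ∈-edges-reverseʷ⁻ (P₂ ++ʷ R)

    edges-C : edges C ↭ edges P₂ ++ edges R
    edges-C = begin
      edges C                     ≡⟨ edges-reverseʷ (P₂ ++ʷ R) ⟩
      reverse (edges (P₂ ++ʷ R))  ↭⟨ ↭-reverse (edges (P₂ ++ʷ R)) ⟩
      edges (P₂ ++ʷ R)            ≡⟨ edges-++ʷ P₂ R ⟩
      edges P₂ ++ edges R         ∎
      where open PermutationReasoning

    C-path : IsPath C
    C-path = IsPath-reverseʷ (P₂ ++ʷ R) (IsPath-++ʷ⁺ P₂ R P₂-path R-path vertices-disjoint (proj₂ P₂R))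
      where
      vertices-disjoint : Disjoint (vertices P₂) (tail-vertices R)
      vertices-disjoint (t∈P₂ , t∈R) with proj₁ P₂R t∈P₂ (there t∈R)
      ... | inj₁ refl = x∉P₂ t∈P₂
      ... | inj₂ refl = Unique[x∷xs]⇒x∉xs (proj₁ R-path) t∈R

    P₁C : InternallyDisjointʷ P₁ C
    P₁C = meet , λ (e∈P₁ , e∈C) → [ (λ e∈P₂ → P₁P₂-edges (e∈P₁ , e∈P₂))
                                    , (λ e∈R → proj₂ P₁R (e∈P₁ , e∈R)) ]′ (∈C-edges⁻ e∈C)
      where
      meet : ∀ {t} → t ∈ₗ vertices P₁ → t ∈ₗ vertices C → t ≡ x ⊎ t ≡ z
      meet t∈P₁ t∈C with ∈C⁻ t∈C
      ... | inj₁ (here refl) = inj₂ refl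
      ... | inj₁ (there t∈)  = ⊥-elim (P₁P₂-vertices (t∈P₁ , t∈))
      ... | inj₂ t∈R with proj₁ P₁R t∈P₁ (there t∈R) | end∈vertices P₂
      ...   | inj₁ t≡x  | _          = inj₁ t≡x
      ...   | inj₂ refl | here y≡z   = inj₂ y≡z
      ...   | inj₂ refl | there y∈P₂ = ⊥-elim (P₁P₂-vertices (t∈P₁ , y∈P₂))

    module Q₁-properties (Q₁ : Walk x z) (Q₁-path : IsPath Q₁) (Q₁P : InternallyDisjointʷ Q₁ (P₁ ++ʷ P₂))
             (Q₁R : MeetOnlyAt x y Q₁ R) where

      P₁Q₁ : InternallyDisjointʷ P₁ Q₁
      P₁Q₁ = (λ t∈P₁ t∈Q₁ → proj₁ Q₁P t∈Q₁ (∈-vertices-++ʷ⁺ˡ P₁ P₂ t∈P₁))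
           , (λ (e∈P₁ , e∈Q₁) → proj₂ Q₁P (e∈Q₁ , ∈-edges-++ʷ⁺ˡ P₁ P₂ e∈P₁))

      Q₁C : InternallyDisjointʷ Q₁ C
      Q₁C = meet , λ (e∈Q₁ , e∈C) → [ (λ e∈P₂ → proj₂ Q₁P (e∈Q₁ , ∈-edges-++ʷ⁺ʳ P₁ P₂ e∈P₂))
                                      , (λ e∈R → proj₂ Q₁R (e∈Q₁ , e∈R)) ]′ (∈C-edges⁻ e∈C)
        where
        meet : ∀ {t} → t ∈ₗ vertices Q₁ → t ∈ₗ vertices C → t ≡ x ⊎ t ≡ z
        meet t∈Q₁ t∈C with ∈C⁻ t∈C
        ... | inj₁ t∈P₂ = proj₁ Q₁P t∈Q₁ (∈-vertices-++ʷ⁺ʳ P₁ P₂ t∈P₂)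
        ... | inj₂ t∈R with proj₁ Q₁R t∈Q₁ (there t∈R)
        ...   | inj₁ t≡x  = inj₁ t≡x
        ...   | inj₂ refl = proj₁ Q₁P t∈Q₁ (end∈vertices (P₁ ++ʷ P₂))

      Q₁P₂-path : IsPath (Q₁ ++ʷ P₂)
      Q₁P₂-path = IsPath-++ʷ⁺ Q₁ P₂ Q₁-path P₂-path vertices-disjoint
                    (λ (e∈Q₁ , e∈P₂) → proj₂ Q₁P (e∈Q₁ , ∈-edges-++ʷ⁺ʳ P₁ P₂ e∈P₂))
        where
        vertices-disjoint : Disjoint (vertices Q₁) (tail-vertices P₂)
        vertices-disjoint (t∈Q₁ , t∈P₂) with proj₁ Q₁P t∈Q₁ (∈-vertices-++ʷ⁺ʳ P₁ P₂ (there t∈P₂))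
        ... | inj₁ refl = x∉P₂ (there t∈P₂)
        ... | inj₂ refl = Unique[x∷xs]⇒x∉xs (proj₁ P₂-path) t∈P₂

      Q₁P₂R : InternallyDisjointʷ (Q₁ ++ʷ P₂) R
      Q₁P₂R = (λ t∈ t∈R → [ (λ t∈Q₁ → proj₁ Q₁R t∈Q₁ t∈R) , (λ t∈P₂ → proj₁ P₂R (there t∈P₂) t∈R) ]′
                              (∈-vertices-++ʷ⁻ Q₁ P₂ t∈))
            , (λ (e∈ , e∈R) → [ (λ e∈Q₁ → proj₂ Q₁R (e∈Q₁ , e∈R)) , (λ e∈P₂ → proj₂ P₂R (e∈P₂ , e∈R)) ]′
                                  (∈-edges-++ʷ⁻ Q₁ P₂ e∈))

  module _ (u : V G) where

    ¬ContainsVertex-++ : (A : Walk x y) (B : Walk a b) → u ∉ₗ vertices A → u ∉ₗ vertices B →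
                         ¬ ContainsVertex G (toSubset (edges A ++ edges B)) u
    ¬ContainsVertex-++ A B u∉A u∉B (e , e∈ , inc) with ∈-++⁻ (edges A) (∈-toSubset⁻ e∈)
    ... | inj₁ e∈A = u∉A (∈-vertices-incident A e∈A inc)
    ... | inj₂ e∈B = u∉B (∈-vertices-incident B e∈B inc)

    record CycleThrough : Set where
      field
        {start end}          : V G
        first-edge last-edge : E G
        joins-first          : Joins G first-edge u start
        joins-last           : Joins G last-edge end u
        path                 : Walk start end
        isPath               : IsPath path
        u∉path               : u ∉ₗ vertices path
        first≢last           : first-edge ≢ last-edge

      cycleEdges : List (E G)
      cycleEdges = first-edge ∷ edges path ++ [ last-edge ]

      first∈cycleEdges : first-edge ∈ₗ cycleEdges
      first∈cycleEdges = here refl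

      last∈cycleEdges : last-edge ∈ₗ cycleEdges
      last∈cycleEdges = there (∈-++⁺ʳ (edges path) (here refl))

      first-δ : δ G u
      first-δ = first-edge , Joins⇒IsLink joins-first (λ u≡start → u∉path (subst (_∈ₗ vertices path) (sym u≡start) (here refl))) , Joins⇒Incidentˡ joins-first

      last-δ : δ G u
      last-δ = last-edge , Joins⇒IsLink joins-last (λ end≡u → u∉path (subst (_∈ₗ vertices path) end≡u (end∈vertices path))) , Joins⇒Incidentʳ joins-last

      incident-u : ∀ {e′} → e′ ∈ₗ cycleEdges → Incident G e′ u → e′ ≡ first-edge ⊎ e′ ≡ last-edge
      incident-u (here refl) _ = inj₁ refl
      incident-u (there e′∈) inc with ∈-++⁻ (edges path) e′∈
      ... | inj₁ e′∈path     = ⊥-elim (u∉path (∈-vertices-incident path e′∈path inc))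
      ... | inj₂ (here refl) = inj₂ refl

    open CycleThrough

    reverseᶜ : CycleThrough → CycleThrough
    reverseᶜ c = record
      { first-edge  = last-edge c
      ; last-edge   = first-edge c
      ; joins-first = Joins-sym (joins-last c)
      ; joins-last  = Joins-sym (joins-first c)
      ; path        = reverseʷ (path c)
      ; isPath      = IsPath-reverseʷ (path c) (isPath c)
      ; u∉path      = u∉path c ∘ ∈-vertices-reverseʷ⁻ (path c)
      ; first≢last  = first≢last c ∘ sym
      }

    cycleEdges-reverseᶜ : ∀ c → cycleEdges (reverseᶜ c) ↭ cycleEdges c
    cycleEdges-reverseᶜ c = begin
      l ∷ edges (reverseʷ P) ++ [ f ]  ≡⟨ cong (λ es → l ∷ es ++ [ f ]) (edges-reverseʷ P) ⟩
      l ∷ reverse (edges P) ++ [ f ]   ↭⟨ ++⁺ˡ [ l ] (++⁺ʳ [ f ] (↭-reverse (edges P))) ⟩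
      l ∷ edges P ++ [ f ]             ↭⟨ solve 3 (λ l P f → l ⊕ (P ⊕ f) ⊜ f ⊕ (P ⊕ l)) ↭-refl [ l ] (edges P) [ f ] ⟩
      f ∷ edges P ++ [ l ]             ∎
      where
      open PermutationReasoning
      f l : E G
      f = first-edge c
      l = last-edge c
      P : Walk (CycleThrough.start c) (CycleThrough.end c)
      P = path c

    ClosedPath⇒CycleThrough : ∀ {S} (c : ClosedPath u S) → (d : δ G u) → proj₁ d ∈ S →
                              Σ[ c′ ∈ CycleThrough ] toSubset (cycleEdges c′) ≡ S
    ClosedPath⇒CycleThrough record { path = nil ; closes = loop ; edge-set = refl } (d , link , _) d∈S
      with ∈-toSubset⁻ d∈S
    ... | here refl = ⊥-elim (Joins-self⇒¬IsLink loop link)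
    ClosedPath⇒CycleThrough record { path = cons e j P ; closing = g ; closes = jg
                                   ; vertices-unique = vs! ; edges-unique = es! ; edge-set = refl } _ _ =
      record { first-edge = e ; last-edge = g ; joins-first = j ; joins-last = jg ; path = P
             ; isPath = IsPath-cons⁻ {j = j} (vs! , Unique-++⁻ˡ (e ∷ edges P) es!)
             ; u∉path = Unique[x∷xs]⇒x∉xs vs!
             ; first≢last    = λ { refl → Unique[x∷xs]⇒x∉xs es! (∈-++⁺ʳ (edges P) (here refl)) } }
      , refl

    IsCycle⇒CycleThrough : ∀ {S} → IsCycle G S → (d : δ G u) → proj₁ d ∈ S →
                           Σ[ c ∈ CycleThrough ] toSubset (cycleEdges c) ≡ S
    IsCycle⇒CycleThrough {S} cycle d@(_ , _ , inc) d∈S =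
      ClosedPath⇒CycleThrough (rotate c u∈path) d d∈S
      where
      c : ClosedPath _ S
      c = proj₂ (IsCycle⇒ClosedPath cycle)
      open ClosedPath c using (closes; edge-set) renaming (path to P)
      u∈path : u ∈ₗ vertices P
      u∈path with ∈-++⁻ (edges P) (∈-toSubset⁻ (subst (_ ∈_) (sym edge-set) d∈S))
      ... | inj₁ d∈P = ∈-vertices-incident P d∈P inc
      ... | inj₂ (here refl) with Joins-Incident closes inc
      ...   | inj₁ refl = end∈vertices P
      ...   | inj₂ refl = here refl

  module _ (𝓑 : Subset (Graph.m G) → Bool) where

    BalancedEdges : List (E G) → Set
    BalancedEdges es = Balanced G 𝓑 (toSubset es)

    BalancedEdges-resp-↭ : ∀ {es es′} → es ↭ es′ → BalancedEdges es → BalancedEdges es′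
    BalancedEdges-resp-↭ es↭es′ = subst (Balanced G 𝓑) (toSubset-resp-↭ es↭es′)

    module _ (biased : IsBiased G 𝓑) where

      theta : (A B C : Walk x y) → x ≢ y → IsPath A → IsPath B → IsPath C →
              InternallyDisjointʷ A B → InternallyDisjointʷ A C → InternallyDisjointʷ B C →
              BalancedEdges (edges A ++ edges B) → BalancedEdges (edges A ++ edges C) →
              BalancedEdges (edges B ++ edges C)
      theta {x} {y} A B C x≢y A-path B-path C-path AB AC BC AB-balanced AC-balanced
        with 𝓑 (toSubset (edges B ++ edges C)) Bool.≟ true
      ... | yes BC-balanced = BC-balanced
      ... | no  BC-unbalanced = ⊥-elim $ proj₂ biased x y x≢y (toPath x≢y A A-path) (toPath x≢y B B-path) (toPath x≢y C C-path)
              (InternallyDisjoint-toPath x≢y A B A-path B-path AB)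
              (InternallyDisjoint-toPath x≢y A C A-path C-path AC)
              (InternallyDisjoint-toPath x≢y B C B-path C-path BC)
              ( subst (Balanced G 𝓑) (sym (∪-toPath A B A-path B-path)) AB-balanced
              , subst (Balanced G 𝓑) (sym (∪-toPath A C A-path C-path)) AC-balanced
              , BC-unbalanced ∘ subst (Balanced G 𝓑) (∪-toPath B C B-path C-path))
        where
        ∪-toPath : (W W′ : Walk x y) (p : IsPath W) (p′ : IsPath W′) →
                   edgeSet G (toPath x≢y W p) ∪ edgeSet G (toPath x≢y W′ p′) ≡ toSubset (edges W ++ edges W′)
        ∪-toPath W W′ p p′ = trans (cong₂ _∪_ (edgeSet-toPath x≢y W p) (edgeSet-toPath x≢y W′ p′))
                                   (sym (toSubset-++ (edges W) (edges W′)))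

      module BalancingVertex (u : V G) (balancing : IsBalancingVertex G 𝓑 u) where
        open import Data.List.Membership.DecPropositional (_≟_ {Graph.n G}) using (_∈?_)

        balanced-off-u : (A B : Walk x z) → x ≢ z → IsPath A → IsPath B → InternallyDisjointʷ A B →
                         u ∉ₗ vertices A → u ∉ₗ vertices B → BalancedEdges (edges A ++ edges B)
        balanced-off-u A B x≢z A-path B-path AB u∉A u∉B =
          balancing _ (internally-disjoint⇒IsCycle A B x≢z A-path B-path AB) (¬ContainsVertex-++ u A B u∉A u∉B)

        record FreeSide (R : Walk y x) (P : Walk x y) : Set where
          field
            isPath  : IsPath P
            avoids  : u ∉ₗ vertices P
            meets-R : InternallyDisjointʷ P R

        -- Q leaves P along q and first returns to P at z.  The x–z paths P₁ along P, Q₁ along Q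
        -- and C around the rest of the cycle P R form a theta graph in which P₁ ∪ Q₁ avoids u.
        reroute-new-edge : ∀ {x x′ y q} (j : Joins G q x x′) (Q : Walk x′ y) (P : Walk x y) (R : Walk y x) →
          IsPath R → FreeSide R P → FreeSide R (cons q j Q) → q ∉ₗ edges P →
          BalancedEdges (edges P ++ edges R) →
          Σ[ P′ ∈ Walk x′ y ] FreeSide R (cons q j P′) × BalancedEdges (q ∷ edges P′ ++ edges R)
        reroute-new-edge {x} {q = q} j Q P R R-path P-side Q-side q∉P PR-balanced
          with splitAtFirst (_∈? vertices P) Q (end∈vertices P)
        ... | record { prefix = Qₐ ; suffix = Q_b ; split = refl ; P-meet = z∈P ; first = first }
          with splitAt P z∈P
        ... | P₁ , P₂ , refl = Qₐ ++ʷ P₂ , new-side , new-balanced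
          where
          open FreeSide P-side renaming (isPath to P-path; avoids to u∉P; meets-R to PR)
          open FreeSide Q-side renaming (isPath to Q-path; avoids to u∉Q; meets-R to QR)

          Q₁ : Walk x _
          Q₁ = cons q j Qₐ

          x∉Q : x ∉ₗ tail-vertices (Q₁ ++ʷ Q_b)
          x∉Q = Unique[x∷xs]⇒x∉xs (proj₁ Q-path)

          x≢z : x ≢ _
          x≢z refl = x∉Q (∈-vertices-++ʷ⁺ˡ Qₐ Q_b (end∈vertices Qₐ))

          Q₁-path : IsPath Q₁
          Q₁-path = IsPathSplit.prefix-isPath (IsPath-++ʷ⁻ Q₁ Q_b Q-path)

          Q₁P : InternallyDisjointʷ Q₁ P
          Q₁P = (λ { (here refl) _ → inj₁ refl ; (there t∈Qₐ) t∈P → inj₂ (first t∈Qₐ t∈P) })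
              , λ { (here refl , q∈P) → q∉P q∈P
                  ; (there e∈Qₐ , e∈P) → meets-at-end⇒edges-disjoint Qₐ P (proj₁ (IsPath-cons⁻ {j = j} Q₁-path))
                                            first (e∈Qₐ , e∈P) }

          open Handle P₁ P₂ R x≢z P-path R-path PR
          open Q₁-properties Q₁ Q₁-path Q₁P (MeetOnlyAt-++ʷ⁻ˡ Q₁ Q_b QR)

          P₁C-balanced : BalancedEdges (edges P₁ ++ edges C)
          P₁C-balanced = BalancedEdges-resp-↭ (begin
            edges P ++ edges R                 ≡⟨ cong (_++ edges R) (edges-++ʷ P₁ P₂) ⟩
            (edges P₁ ++ edges P₂) ++ edges R  ≡⟨ ++-assoc (edges P₁) (edges P₂) (edges R) ⟩
            edges P₁ ++ edges P₂ ++ edges R    ↭⟨ ++⁺ˡ (edges P₁) edges-C ⟨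
            edges P₁ ++ edges C                ∎) PR-balanced
            where open PermutationReasoning

          P₁Q₁-balanced : BalancedEdges (edges P₁ ++ edges Q₁)
          P₁Q₁-balanced = balanced-off-u P₁ Q₁ x≢z P₁-path Q₁-path
                            P₁Q₁ (u∉P ∘ ∈-vertices-++ʷ⁺ˡ P₁ P₂) (u∉Q ∘ ∈-vertices-++ʷ⁺ˡ Q₁ Q_b)

          new-balanced : BalancedEdges (q ∷ edges (Qₐ ++ʷ P₂) ++ edges R)
          new-balanced = BalancedEdges-resp-↭ (begin
            edges Q₁ ++ edges C                    ↭⟨ ++⁺ˡ (edges Q₁) edges-C ⟩
            q ∷ edges Qₐ ++ edges P₂ ++ edges R    ≡⟨ cong (q ∷_) (++-assoc (edges Qₐ) (edges P₂) (edges R)) ⟨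
            q ∷ (edges Qₐ ++ edges P₂) ++ edges R  ≡⟨ cong (λ es → q ∷ es ++ edges R) (edges-++ʷ Qₐ P₂) ⟨
            q ∷ edges (Qₐ ++ʷ P₂) ++ edges R       ∎)
            (theta P₁ Q₁ C x≢z P₁-path Q₁-path C-path
                   P₁Q₁ P₁C Q₁C P₁Q₁-balanced P₁C-balanced)
            where open PermutationReasoning

          new-side : FreeSide R (Q₁ ++ʷ P₂)
          new-side = record
            { isPath  = Q₁P₂-path
            ; avoids  = [ u∉Q ∘ ∈-vertices-++ʷ⁺ˡ Q₁ Q_b , u∉P ∘ ∈-vertices-++ʷ⁺ʳ P₁ P₂ ∘ there ]′
                          ∘ ∈-vertices-++ʷ⁻ Q₁ P₂
            ; meets-R = Q₁P₂R
            }

        reroute-first-edge : ∀ {x x′ y q} (j : Joins G q x x′) (Q : Walk x′ y) (P : Walk x y) (R : Walk y x) →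
          x ≢ y → IsPath R → FreeSide R P → FreeSide R (cons q j Q) → BalancedEdges (edges P ++ edges R) →
          Σ[ P′ ∈ Walk x′ y ] FreeSide R (cons q j P′) × BalancedEdges (q ∷ edges P′ ++ edges R)
        reroute-first-edge j Q nil R x≢y _ _ _ _ = ⊥-elim (x≢y refl)
        reroute-first-edge {q = q} j Q (cons p jp P) R x≢y R-path P-side Q-side PR-balanced with p ≟ q
        ... | yes refl with Joins-functional jp j
        ...   | refl = P , record { P-side′ } , PR-balanced
          where module P-side′ = FreeSide P-side
        reroute-first-edge {q = q} j Q (cons p jp P) R x≢y R-path P-side Q-side PR-balanced | no p≢q =
          reroute-new-edge j Q (cons p jp P) R R-path P-side Q-side q∉P PR-balanced
          where
          q∉P : q ∉ₗ edges (cons p jp P)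
          q∉P (here q≡p)  = p≢q (sym q≡p)
          q∉P (there q∈P) = Unique[x∷xs]⇒x∉xs (proj₁ (FreeSide.isPath P-side))
                              (∈-vertices-incident P q∈P (Joins⇒Incidentˡ j))

        FreeSide-shift : ∀ {x x′ y q} (j : Joins G q x x′) (W : Walk x′ y) (R : Walk y x) →
                         FreeSide R (cons q j W) → FreeSide (R ++ʷ cons q j nil) W
        FreeSide-shift j W R record { isPath = W-path@(x∉W ∷ _ , q∉W ∷ _) ; avoids = u∉W ; meets-R = (meet , disjoint) } =
          record { isPath = IsPath-cons⁻ {j = j} W-path ; avoids = u∉W ∘ there ; meets-R = meet′ , disjoint′ }
          where
          meet′ : ∀ {t} → t ∈ₗ vertices W → t ∈ₗ vertices (R ++ʷ cons _ j nil) → t ≡ _ ⊎ t ≡ _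
          meet′ t∈W t∈ with ∈-vertices-++ʷ⁻ R (cons _ j nil) t∈
          ... | inj₂ (here refl) = inj₁ refl
          ... | inj₁ t∈R with meet (there t∈W) t∈R
          ...   | inj₁ refl = ⊥-elim (All.lookup x∉W t∈W refl)
          ...   | inj₂ t≡y  = inj₂ t≡y
          disjoint′ : Disjoint (edges W) (edges (R ++ʷ cons _ j nil))
          disjoint′ (e∈W , e∈) with ∈-edges-++ʷ⁻ R (cons _ j nil) e∈
          ... | inj₁ e∈R         = disjoint (there e∈W , e∈R)
          ... | inj₂ (here refl) = All.lookup q∉W e∈W refl

        -- Induction on Q: make P start with the first edge q of Q, then move q from both paths into R.
        reroute : (Q P : Walk x y) (R : Walk y x) → x ≢ y → IsPath R → FreeSide R P → FreeSide R Q →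
                  BalancedEdges (edges P ++ edges R) → BalancedEdges (edges Q ++ edges R)
        reroute nil P R x≢y _ _ _ _ = ⊥-elim (x≢y refl)
        reroute {y = y} (cons {y = x′} q j Q) P R x≢y R-path P-side Q-side PR-balanced
          with reroute-first-edge j Q P R x≢y R-path P-side Q-side PR-balanced | x′ ≟ y
        ... | P′ , P′-side , P′R-balanced | yes refl =
          subst (λ es → BalancedEdges (q ∷ es ++ edges R))
                (trans (closed-path-edges P′ (Unique-tail (FreeSide.isPath P′-side)))
                       (sym (closed-path-edges Q (Unique-tail (FreeSide.isPath Q-side)))))
                P′R-balanced
          where
          Unique-tail : ∀ {W : Walk x′ x′} → IsPath (cons q j W) → Unique (vertices W)
          Unique-tail = proj₁ ∘ IsPath-cons⁻ {j = j}
        ... | P′ , P′-side , P′R-balanced | no x′≢y =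
          BalancedEdges-resp-↭ (↭-sym (move-q Q))
            (reroute Q P′ (R ++ʷ cons q j nil) x′≢y R′-path
               (FreeSide-shift j P′ R P′-side) (FreeSide-shift j Q R Q-side)
               (BalancedEdges-resp-↭ (move-q P′) P′R-balanced))
          where
          move-q : (W : Walk x′ y) → q ∷ edges W ++ edges R ↭ edges W ++ edges (R ++ʷ cons q j nil)
          move-q W = begin
            q ∷ edges W ++ edges R                ↭⟨ solve 3 (λ q W R → q ⊕ (W ⊕ R) ⊜ W ⊕ (R ⊕ q)) ↭-refl
                                                       [ q ] (edges W) (edges R) ⟩
            edges W ++ edges R ++ [ q ]           ≡⟨ cong (edges W ++_) (edges-++ʷ R (cons q j nil)) ⟨
            edges W ++ edges (R ++ʷ cons q j nil) ∎
            where open PermutationReasoning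
          R′-path : IsPath (R ++ʷ cons q j nil)
          R′-path = IsPath-++ʷ⁺ R (cons q j nil) R-path
            (IsPathSplit.prefix-isPath (IsPath-++ʷ⁻ (cons q j nil) Q (FreeSide.isPath Q-side)))
            (λ { (t∈R , here refl) → x′-on-R t∈R })
            (λ { (q∈R , here refl) → proj₂ (FreeSide.meets-R Q-side) (here refl , q∈R) })
            where
            x′-on-R : x′ ∉ₗ vertices R
            x′-on-R x′∈R with proj₁ (FreeSide.meets-R Q-side) (there (here refl)) x′∈R
            ... | inj₁ refl = Unique[x∷xs]⇒x∉xs (proj₁ (FreeSide.isPath Q-side)) (here refl)
            ... | inj₂ x′≡y = x′≢y x′≡y

        open CycleThrough

        via-u : (c : CycleThrough u) → Walk (end c) (start c)
        via-u c = cons (last-edge c) (joins-last c) (cons (first-edge c) (joins-first c) nil)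

        FreeSide-via-u : (c : CycleThrough u) → FreeSide (via-u c) (path c)
        FreeSide-via-u c = record { isPath = isPath c ; avoids = u∉path c ; meets-R = meet , disjoint }
          where
          meet : ∀ {t} → t ∈ₗ vertices (path c) → t ∈ₗ vertices (via-u c) → t ≡ start c ⊎ t ≡ end c
          meet _   (here refl)                 = inj₂ refl
          meet t∈P (there (here refl))         = ⊥-elim (u∉path c t∈P)
          meet _   (there (there (here refl))) = inj₁ refl
          disjoint : Disjoint (edges (path c)) (edges (via-u c))
          disjoint (e∈P , here refl) = u∉path c (∈-vertices-incident (path c) e∈P (Joins⇒Incidentʳ (joins-last c)))
          disjoint (e∈P , there (here refl)) =
            u∉path c (∈-vertices-incident (path c) e∈P (Joins⇒Incidentˡ (joins-first c)))

        IsPath-via-u : (c : CycleThrough u) → start c ≢ end c → IsPath (via-u c)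
        IsPath-via-u c start≢end =
            Unique-∷⁺ (λ { (here end≡u) → u∉end end≡u ; (there (here end≡start)) → start≢end (sym end≡start) })
              (Unique-∷⁺ (λ { (here u≡start) → u∉path c (subst (_∈ₗ vertices (path c)) (sym u≡start) (here refl)) })
                (Unique-∷⁺ (λ ()) []))
          , Unique-∷⁺ (λ { (here last≡first) → first≢last c (sym last≡first) }) (Unique-∷⁺ (λ ()) [])
          where
          u∉end : end c ≢ u
          u∉end end≡u = u∉path c (subst (_∈ₗ vertices (path c)) end≡u (end∈vertices (path c)))

        from-u : (c : CycleThrough u) → Walk u (end c)
        from-u c = cons (first-edge c) (joins-first c) (path c)

        back : (c : CycleThrough u) → Walk (end c) u
        back c = cons (last-edge c) (joins-last c) nil

        IsPath-from-u : (c : CycleThrough u) → IsPath (from-u c)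
        IsPath-from-u c = IsPath-cons⁺ (joins-first c) (path c) (u∉path c) (isPath c)

        IsPath-back : (c : CycleThrough u) → IsPath (back c)
        IsPath-back c = Unique-∷⁺ (λ { (here end≡u) → u∉path c (subst (_∈ₗ vertices (path c)) end≡u (end∈vertices (path c))) })
                          (Unique-∷⁺ (λ ()) [])
                      , Unique-∷⁺ (λ ()) []

        InternallyDisjoint-from-u-back : (c : CycleThrough u) → InternallyDisjointʷ (from-u c) (back c)
        InternallyDisjoint-from-u-back c =
            (λ { _ (here refl) → inj₂ refl ; _ (there (here refl)) → inj₁ refl })
          , λ { (here refl , here first≡last) → first≢last c first≡last
              ; (there h∈P , here refl) → u∉path c (∈-vertices-incident (path c) h∈P (Joins⇒Incidentʳ (joins-last c))) }

        cycleEdges↭ : (c : CycleThrough u) → cycleEdges c ↭ edges (path c) ++ edges (via-u c)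
        cycleEdges↭ c = solve 3 (λ e P f → e ⊕ (P ⊕ f) ⊜ P ⊕ (f ⊕ e)) ↭-refl
                          [ first-edge c ] (edges (path c)) [ last-edge c ]

        same-ends-balanced : (c c′ : CycleThrough u) → first-edge c ≡ first-edge c′ → last-edge c ≡ last-edge c′ →
                             BalancedEdges (cycleEdges c′) → BalancedEdges (cycleEdges c)
        same-ends-balanced c@record { start = a ; end = b ; joins-first = je ; joins-last = jf ; path = P }
                           c′@record { start = a′ ; end = b′ ; joins-first = je′ ; joins-last = jf′ ; path = P′ }
                           refl refl c′-balanced
          with Joins-functional je′ je | Joins-functional (Joins-sym jf′) (Joins-sym jf) | a ≟ b
        ... | refl | refl | yes refl =
          subst (λ es → BalancedEdges (first-edge c ∷ es ++ [ last-edge c ]))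
                (trans (closed-path-edges P′ (proj₁ (isPath c′))) (sym (closed-path-edges P (proj₁ (isPath c)))))
                c′-balanced
        ... | refl | refl | no a≢b =
          BalancedEdges-resp-↭ (↭-sym (cycleEdges↭ c))
            (reroute P P′ (via-u c) a≢b (IsPath-via-u c a≢b) (record { P′-side }) (FreeSide-via-u c)
              (BalancedEdges-resp-↭ (cycleEdges↭ c′) c′-balanced))
          where module P′-side = FreeSide (FreeSide-via-u c′)

        balanced-trans : (c₁ c₂ : CycleThrough u) → last-edge c₁ ≡ first-edge c₂ → first-edge c₁ ≢ last-edge c₂ →
                         BalancedEdges (cycleEdges c₁) → BalancedEdges (cycleEdges c₂) →
                         Σ[ c₃ ∈ CycleThrough u ] first-edge c₃ ≡ first-edge c₁ × last-edge c₃ ≡ last-edge c₂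
                                                  × BalancedEdges (cycleEdges c₃)
        balanced-trans c₁@record { first-edge = e ; last-edge = f ; joins-last = jf ; path = P₁ }
                       c₂@record { first-edge = .f ; last-edge = g ; joins-first = jf′ ; path = P₂ } refl e≢g c₁-balanced c₂-balanced
          with Joins-functional (Joins-sym jf) jf′
        ... | refl with splitAtFirst (_∈? vertices P₂) P₁ (here refl)
        ... | record { prefix = A₁ ; suffix = A₂ ; split = refl ; P-meet = x∈P₂ ; first = first }
          with splitAt P₂ x∈P₂
        ... | B₁ , B₂ , refl = c₃ , refl , refl , c₃-balanced
          where
          TA : Walk u _
          TA = cons e (joins-first c₁) A₁

          TB : Walk u _
          TB = cons f jf′ B₁

          u≢x : u ≢ _
          u≢x u≡x = u∉path c₂ (subst (_∈ₗ vertices P₂) (sym u≡x) x∈P₂)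

          u-edge∉P₁ : ∀ {h} → Incident G h u → h ∉ₗ edges P₁
          u-edge∉P₁ inc h∈P₁ = u∉path c₁ (∈-vertices-incident P₁ h∈P₁ inc)

          u-edge∉P₂ : ∀ {h} → Incident G h u → h ∉ₗ edges P₂
          u-edge∉P₂ inc h∈P₂ = u∉path c₂ (∈-vertices-incident P₂ h∈P₂ inc)

          TA-path : IsPath TA
          TA-path = IsPathSplit.prefix-isPath (IsPath-++ʷ⁻ TA A₂ (IsPath-from-u c₁))

          A₁P₂ : Disjoint (edges A₁) (edges P₂)
          A₁P₂ = meets-at-end⇒edges-disjoint A₁ P₂ (proj₁ (IsPath-cons⁻ {j = joins-first c₁} TA-path)) first

          TA-P₂ : InternallyDisjointʷ TA (TB ++ʷ B₂)
          TA-P₂ = meet , disjoint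
            where
            meet : ∀ {t} → t ∈ₗ vertices TA → t ∈ₗ vertices (TB ++ʷ B₂) → t ≡ u ⊎ t ≡ _
            meet (here refl) _ = inj₁ refl
            meet (there t∈A₁) (here refl) = ⊥-elim (u∉path c₁ (∈-vertices-++ʷ⁺ˡ A₁ A₂ t∈A₁))
            meet (there t∈A₁) (there t∈P₂) = inj₂ (first t∈A₁ t∈P₂)
            disjoint : Disjoint (edges TA) (edges (TB ++ʷ B₂))
            disjoint (here refl , here e≡f) = first≢last c₁ e≡f
            disjoint (here refl , there e∈P₂) = u-edge∉P₂ (Joins⇒Incidentˡ (joins-first c₁)) e∈P₂
            disjoint (there h∈A₁ , here refl) = u-edge∉P₁ (Joins⇒Incidentʳ jf) (∈-edges-++ʷ⁺ˡ A₁ A₂ h∈A₁)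
            disjoint (there h∈A₁ , there h∈P₂) = A₁P₂ (h∈A₁ , h∈P₂)

          TA-back : MeetOnlyAt u (end c₂) TA (back c₂)
          TA-back = (λ { _ (here refl) → inj₂ refl ; _ (there (here refl)) → inj₁ refl })
                  , λ { (here refl , here e≡g) → e≢g e≡g
                      ; (there h∈A₁ , here refl) → u-edge∉P₁ (Joins⇒Incidentʳ (joins-last c₂)) (∈-edges-++ʷ⁺ˡ A₁ A₂ h∈A₁) }

          open Handle TB B₂ (back c₂) u≢x (IsPath-from-u c₂) (IsPath-back c₂) (InternallyDisjoint-from-u-back c₂)
          open Q₁-properties TA TA-path TA-P₂ TA-back

          c₄ : CycleThrough u
          c₄ = record
            { first-edge = e ; last-edge = f ; joins-first = joins-first c₁ ; joins-last = jf
            ; path = A₁ ++ʷ reverseʷ B₁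
            ; isPath = IsPath-++ʷ-reverseʷ A₁ B₁ (IsPath-cons⁻ {j = joins-first c₁} TA-path)
                         (IsPath-cons⁻ {j = jf′} P₁-path) (λ t∈A₁ → first t∈A₁ ∘ ∈-vertices-++ʷ⁺ˡ B₁ B₂)
                         (λ (h∈A₁ , h∈B₁) → A₁P₂ (h∈A₁ , ∈-edges-++ʷ⁺ˡ B₁ B₂ h∈B₁))
            ; u∉path = [ u∉path c₁ ∘ ∈-vertices-++ʷ⁺ˡ A₁ A₂
                       , u∉path c₂ ∘ ∈-vertices-++ʷ⁺ˡ B₁ B₂ ∘ ∈-vertices-reverseʷ⁻ B₁ ∘ there ]′
                       ∘ ∈-vertices-++ʷ⁻ A₁ (reverseʷ B₁)
            ; first≢last = first≢last c₁
            }

          TB-TA-balanced : BalancedEdges (edges TB ++ edges TA)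
          TB-TA-balanced = BalancedEdges-resp-↭ (begin
            e ∷ edges (A₁ ++ʷ reverseʷ B₁) ++ [ f ]          ≡⟨ cong (λ es → e ∷ es ++ [ f ]) (edges-++ʷ A₁ (reverseʷ B₁)) ⟩
            e ∷ (edges A₁ ++ edges (reverseʷ B₁)) ++ [ f ]   ≡⟨ cong (λ es → e ∷ (edges A₁ ++ es) ++ [ f ]) (edges-reverseʷ B₁) ⟩
            e ∷ (edges A₁ ++ reverse (edges B₁)) ++ [ f ]    ↭⟨ ++⁺ˡ [ e ] (++⁺ʳ [ f ] (++⁺ˡ (edges A₁) (↭-reverse (edges B₁)))) ⟩
            e ∷ (edges A₁ ++ edges B₁) ++ [ f ]              ↭⟨ solve 4 (λ e A B f → e ⊕ ((A ⊕ B) ⊕ f) ⊜ (f ⊕ B) ⊕ (e ⊕ A)) ↭-refl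
                                                                  [ e ] (edges A₁) (edges B₁) [ f ] ⟩
            edges TB ++ edges TA                             ∎)
            (same-ends-balanced c₄ c₁ refl refl c₁-balanced)
            where open PermutationReasoning

          TB-C-balanced : BalancedEdges (edges TB ++ edges C)
          TB-C-balanced = BalancedEdges-resp-↭ (begin
            f ∷ edges (B₁ ++ʷ B₂) ++ [ g ]         ≡⟨ cong (λ es → f ∷ es ++ [ g ]) (edges-++ʷ B₁ B₂) ⟩
            f ∷ (edges B₁ ++ edges B₂) ++ [ g ]    ≡⟨ cong (f ∷_) (++-assoc (edges B₁) (edges B₂) [ g ]) ⟩
            f ∷ edges B₁ ++ edges B₂ ++ [ g ]      ↭⟨ ++⁺ˡ (f ∷ edges B₁) edges-C ⟨
            edges TB ++ edges C                    ∎) c₂-balanced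
            where open PermutationReasoning

          c₃ : CycleThrough u
          c₃ = record
            { first-edge = e ; last-edge = g ; joins-first = joins-first c₁ ; joins-last = joins-last c₂
            ; path = A₁ ++ʷ B₂
            ; isPath = IsPath-cons⁻ {j = joins-first c₁} Q₁P₂-path
            ; u∉path = Unique[x∷xs]⇒x∉xs (proj₁ Q₁P₂-path)
            ; first≢last = e≢g
            }

          c₃-balanced : BalancedEdges (cycleEdges c₃)
          c₃-balanced = BalancedEdges-resp-↭ (begin
            edges TA ++ edges C                    ↭⟨ ++⁺ˡ (edges TA) edges-C ⟩
            e ∷ edges A₁ ++ edges B₂ ++ [ g ]      ≡⟨ cong (e ∷_) (++-assoc (edges A₁) (edges B₂) [ g ]) ⟨
            e ∷ (edges A₁ ++ edges B₂) ++ [ g ]    ≡⟨ cong (λ es → e ∷ es ++ [ g ]) (edges-++ʷ A₁ B₂) ⟨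
            cycleEdges c₃                          ∎)
            (theta TB TA C u≢x P₁-path TA-path C-path P₁Q₁ P₁C Q₁C TB-TA-balanced TB-C-balanced)
            where open PermutationReasoning

        BalancedThrough : E G → E G → Set
        BalancedThrough e f =
          Σ[ c ∈ CycleThrough u ] BalancedEdges (cycleEdges c) × first-edge c ≡ e × last-edge c ≡ f

        BalancedThrough-sym : ∀ {e f} → BalancedThrough e f → BalancedThrough f e
        BalancedThrough-sym (c , c-balanced , refl , refl) =
          reverseᶜ u c , BalancedEdges-resp-↭ (↭-sym (cycleEdges-reverseᶜ u c)) c-balanced , refl , refl

        BalancedThrough-trans : ∀ {e f g} → e ≢ g → BalancedThrough e f → BalancedThrough f g → BalancedThrough e g
        BalancedThrough-trans e≢g (c₁ , c₁-balanced , refl , refl) (c₂ , c₂-balanced , f≡ , refl)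
          with balanced-trans c₁ c₂ (sym f≡) e≢g c₁-balanced c₂-balanced
        ... | c₃ , e≡ , g≡ , c₃-balanced = c₃ , c₃-balanced , e≡ , g≡

        _∼_ : Rel (δ G u) 0ℓ
        d₁ ∼ d₂ = proj₁ d₁ ≡ proj₁ d₂ ⊎ BalancedThrough (proj₁ d₁) (proj₁ d₂)

        ∼-isEquivalence : IsEquivalence _∼_
        ∼-isEquivalence = record
          { refl  = inj₁ refl
          ; sym   = Data.Sum.map sym BalancedThrough-sym
          ; trans = λ {d₁ d₂ d₃} → ∼-trans {d₁} {d₂} {d₃}
          }
          where
          ∼-trans : ∀ {d₁ d₂ d₃} → d₁ ∼ d₂ → d₂ ∼ d₃ → d₁ ∼ d₃
          ∼-trans (inj₁ p) (inj₁ q) = inj₁ (trans p q)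
          ∼-trans (inj₁ p) (inj₂ (c , b , e≡ , f≡)) = inj₂ (c , b , trans e≡ (sym p) , f≡)
          ∼-trans (inj₂ (c , b , e≡ , f≡)) (inj₁ q) = inj₂ (c , b , e≡ , trans f≡ q)
          ∼-trans {d₁} {d₃ = d₃} (inj₂ t₁) (inj₂ t₂) with proj₁ d₁ ≟ proj₁ d₃
          ... | yes d₁≡d₃ = inj₁ d₁≡d₃
          ... | no  d₁≢d₃ = inj₂ (BalancedThrough-trans d₁≢d₃ t₁ t₂)

        HasRelatedPair : Subset (Graph.m G) → Set
        HasRelatedPair S = Σ[ d₁ ∈ δ G u ] Σ[ d₂ ∈ δ G u ]
                         (proj₁ d₁ ≢ proj₁ d₂ × proj₁ d₁ ∈ S × proj₁ d₂ ∈ S × d₁ ∼ d₂)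

        balanced⇒related : (c : CycleThrough u) → BalancedEdges (cycleEdges c) → HasRelatedPair (toSubset (cycleEdges c))
        balanced⇒related c c-balanced =
            first-δ c , last-δ c , first≢last c , ∈-toSubset⁺ (first∈cycleEdges c) , ∈-toSubset⁺ (last∈cycleEdges c)
          , inj₂ (c , c-balanced , refl , refl)

        related⇒balanced : (c : CycleThrough u) → HasRelatedPair (toSubset (cycleEdges c)) → BalancedEdges (cycleEdges c)
        related⇒balanced c (_ , _ , d₁≢d₂ , _ , _ , inj₁ d₁≡d₂) = ⊥-elim (d₁≢d₂ d₁≡d₂)
        related⇒balanced c ((d₁ , _ , d₁-at-u) , (d₂ , _ , d₂-at-u) , d₁≢d₂ , d₁∈ , d₂∈ , inj₂ (c′ , c′-balanced , refl , refl))
          with incident-u c (∈-toSubset⁻ d₁∈) d₁-at-u | incident-u c (∈-toSubset⁻ d₂∈) d₂-at-u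
        ... | inj₁ refl | inj₁ refl = ⊥-elim (d₁≢d₂ refl)
        ... | inj₂ refl | inj₂ refl = ⊥-elim (d₁≢d₂ refl)
        ... | inj₁ refl | inj₂ refl = same-ends-balanced c c′ refl refl c′-balanced
        ... | inj₂ refl | inj₁ refl =
          same-ends-balanced c (reverseᶜ u c′) refl refl
            (BalancedEdges-resp-↭ (↭-sym (cycleEdges-reverseᶜ u c′)) c′-balanced)

lemma1p4 : (G : Graph) (𝓑 : Subset (Graph.m G) → Bool) (u : V G)
    → IsBiased G 𝓑 → IsBalancingVertex G 𝓑 u
    → Σ[ _∼_ ∈ Rel (δ G u) 0ℓ ] (IsEquivalence _∼_
        × (∀ S → IsCycle G S → (Σ[ d ∈ δ G u ] (proj₁ d ∈ S))
            → (Balanced G 𝓑 S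
                 → Σ[ d₁ ∈ δ G u ] Σ[ d₂ ∈ δ G u ]
                     (proj₁ d₁ ≢ proj₁ d₂ × proj₁ d₁ ∈ S × proj₁ d₂ ∈ S × d₁ ∼ d₂))
             × (Σ[ d₁ ∈ δ G u ] Σ[ d₂ ∈ δ G u ]
                     (proj₁ d₁ ≢ proj₁ d₂ × proj₁ d₁ ∈ S × proj₁ d₂ ∈ S × d₁ ∼ d₂)
                 → Balanced G 𝓑 S)))
lemma1p4 G 𝓑 u biased balancing = _∼_ , ∼-isEquivalence , characterisation
  where
  open BalancingVertex G 𝓑 biased u balancing
  characterisation : ∀ S → IsCycle G S → Σ[ d ∈ δ G u ] (proj₁ d ∈ S) →
                     (Balanced G 𝓑 S → HasRelatedPair S) × (HasRelatedPair S → Balanced G 𝓑 S)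
  characterisation S cycle (d , d∈S) with IsCycle⇒CycleThrough G u cycle d d∈S
  ... | c , refl = balanced⇒related c , related⇒balanced c
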